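{- Let $\mathcal{E}$ be an axiom system (set of equations between CCS terms) that is sound modulo $\sim_{\mathtt{RWB}}$. (1) If $t\approx u$ is sound modulo $\sim_{\mathtt{RWB}}$ and $t$ is action-free, then $u$ is action-free. (2) If $\mathcal{E}\vdash t\approx u$ and $t$ is action-free, then a proof of $t\approx u$ from $\mathcal{E}$ uses only action-free equations (equations both of whose sides are action-free).
   Context: Let $\mathcal{A}$ be a set of action names, $\overline{\mathcal{A}}$ the co-names ($\overline{\overline{a}}=a\neq\overline{a}$), $\mathcal{A}_\tau=\mathcal{A}\cup\overline{\mathcal{A}}\cup\{\tau\}$. CCS terms: $t ::= \mathbf{0} \mid x \mid \mu.t \mid t+t \mid t\,\|\,t$, $x$ a variable, $\mu\in\mathcal{A}_\tau$. Transitions (also for open terms, where variables have no transitions): $\mu.t\xrightarrow{\mu}t$; if $t\xrightarrow{\mu}t'$ then $t+u\xrightarrow{\mu}t'$, $u+t\xrightarrow{\mu}t'$, $t\|u\xrightarrow{\mu}t'\|u$, $u\|t\xrightarrow{\mu}u\|t'$; if $t\xrightarrow{\alpha}t'$, $u\xrightarrow{\overline\alpha}u'$ ($\alpha\in\mathcal{A}\cup\overline{\mathcal{A}}$) then $t\|u\xrightarrow{\tau}t'\|u'$. A term $t$ is action-free if $t\xrightarrow{\mu}t'$ holds for no $\mu$, $t'$. With $\xrightarrow{\varepsilon}$ the reflexive-transitive closure of $\xrightarrow{\tau}$, $p\xRightarrow{\mu}q$ means $p\xrightarrow{\varepsilon}\xrightarrow{\mu}\xrightarrow{\varepsilon}q$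 for $\mu\ne\tau$ and $p\xrightarrow{\varepsilon}q$ for $\mu=\tau$, and $p\xRightarrow{\hat\mu}q$ means $p\xrightarrow{\varepsilon}\xrightarrow{\mu}\xrightarrow{\varepsilon}q$. Weak bisimilarity $\sim_{\mathtt{WB}}$: largest symmetric relation on processes such that if $p\sim_{\mathtt{WB}}q$ and $p\xrightarrow{\mu}p'$ then either $\mu=\tau$ and $p'\sim_{\mathtt{WB}}q$, or $q\xRightarrow{\mu}q'$ with $p'\sim_{\mathtt{WB}}q'$. Rooted weak bisimilarity: $p\sim_{\mathtt{RWB}}q$ iff each $p\xrightarrow{\mu}p'$ is matched by $q\xRightarrow{\hat\mu}q'$ with $p'\sim_{\mathtt{WB}}q'$, and symmetrically. An equation $t\approx u$ is sound modulo $\sim_{\mathtt{RWB}}$ if $\sigma(t)\sim_{\mathtt{RWB}}\sigma(u)$ for all closed substitutions $\sigma$; $\mathcal{E}$ is sound if all its equations are. $\mathcal{E}\vdash t\approx u$ means $t\approx u$ is derivable by equational logic: reflexivity, symmetry, transitivity, substitution instances $\sigma(t')\approx\sigma(u')$ of axioms $(t'\approx u')\in\mathcal{E}$ (substitution is only applied to axioms), and congruence rules for $\mu.\,\cdot$, $+$ and $\|$; a proof is a derivation tree/sequence of equations in this system. -}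

module Defs where

open import Data.Empty using (⊥)
open import Data.Nat using (ℕ)
open import Data.Product using (Σ; ∃; ∃₂; _×_; _,_)
open import Data.Sum using (_⊎_)
open import Relation.Nullary using (¬_)
open import Relation.Binary.PropositionalEquality using (_≡_)
open import Relation.Binary.Construct.Closure.ReflexiveTransitive using (Star)

module _ {A : Set} where

  data Label : Set where
    nm : A → Label
    co : A → Label

  bar : Label → Label
  bar (nm a) = co a
  bar (co a) = nm a

  data Act : Set where
    τ   : Act
    vis : Label → Act

  data Term (V : Set) : Set where
    𝟎   : Term V
    var : V → Term V
    _∙_ : Act → Term V → Term V
    _⊕_ : Term V → Term V → Term V
    _∥_ : Term V → Term V → Term V

  infixr 30 _∙_
  infix 4 _—[_]→_
  infixl 20 _⊕_
  infixl 25 _∥_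

  OTerm : Set
  OTerm = Term ℕ

  Proc : Set
  Proc = Term ⊥

  subst : {V W : Set} → (V → Term W) → Term V → Term W
  subst σ 𝟎 = 𝟎
  subst σ (var x) = σ x
  subst σ (μ ∙ t) = μ ∙ subst σ t
  subst σ (t ⊕ u) = subst σ t ⊕ subst σ u
  subst σ (t ∥ u) = subst σ t ∥ subst σ u

  -- transition relation (variables have no transitions)
  data _—[_]→_ {V : Set} : Term V → Act → Term V → Set where
    pre  : ∀ {μ t} → (μ ∙ t) —[ μ ]→ t
    sumL : ∀ {t t' u μ} → t —[ μ ]→ t' → (t ⊕ u) —[ μ ]→ t'
    sumR : ∀ {t t' u μ} → t —[ μ ]→ t' → (u ⊕ t) —[ μ ]→ t'
    parL : ∀ {t t' u μ} → t —[ μ ]→ t' → (t ∥ u) —[ μ ]→ (t' ∥ u)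
    parR : ∀ {t t' u μ} → t —[ μ ]→ t' → (u ∥ t) —[ μ ]→ (u ∥ t')
    sync : ∀ {t t' u u' α} → t —[ vis α ]→ t' → u —[ vis (bar α) ]→ u'
         → (t ∥ u) —[ τ ]→ (t' ∥ u')

  ActionFree : {V : Set} → Term V → Set
  ActionFree t = ∀ μ t' → ¬ (t —[ μ ]→ t')

  _⇒ε_ : Proc → Proc → Set
  p ⇒ε q = Star (λ x y → x —[ τ ]→ y) p q

  _⇒[_]_ : Proc → Act → Proc → Set
  p ⇒[ τ ] q = p ⇒ε q
  p ⇒[ vis α ] q = ∃₂ λ p₁ p₂ → p ⇒ε p₁ × p₁ —[ vis α ]→ p₂ × p₂ ⇒ε q

  _⇒̂[_]_ : Proc → Act → Proc → Set
  p ⇒̂[ μ ] q = ∃₂ λ p₁ p₂ → p ⇒ε p₁ × p₁ —[ μ ]→ p₂ × p₂ ⇒ε q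

  IsWeakBisim : (Proc → Proc → Set) → Set
  IsWeakBisim R =
    (∀ {p q} → R p q → R q p) ×
    (∀ {p q p' μ} → R p q → p —[ μ ]→ p' →
       (μ ≡ τ × R p' q) ⊎ (∃ λ q' → q ⇒[ μ ] q' × R p' q'))

  _~WB_ : Proc → Proc → Set₁
  p ~WB q = Σ (Proc → Proc → Set) λ R → IsWeakBisim R × R p q

  _~RWB_ : Proc → Proc → Set₁
  p ~RWB q =
    (∀ {μ p'} → p —[ μ ]→ p' → ∃ λ q' → q ⇒̂[ μ ] q' × p' ~WB q') ×
    (∀ {μ q'} → q —[ μ ]→ q' → ∃ λ p' → p ⇒̂[ μ ] p' × p' ~WB q')

  Equation : Set
  Equation = OTerm × OTerm

  SoundEq : Equation → Set₁
  SoundEq (t , u) = (σ : ℕ → Proc) → subst σ t ~RWB subst σ u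

  Sound : (Equation → Set) → Set₁
  Sound E = ∀ e → E e → SoundEq e

  EqActionFree : Equation → Set
  EqActionFree (t , u) = ActionFree t × ActionFree u

  infix 4 _⊢_≈_
  data _⊢_≈_ (E : Equation → Set) : OTerm → OTerm → Set where
    ≈refl  : ∀ {t} → E ⊢ t ≈ t
    ≈sym   : ∀ {t u} → E ⊢ t ≈ u → E ⊢ u ≈ t
    ≈trans : ∀ {t u v} → E ⊢ t ≈ u → E ⊢ u ≈ v → E ⊢ t ≈ v
    ≈ax    : ∀ {t u} → E (t , u) → (σ : ℕ → OTerm) → E ⊢ subst σ t ≈ subst σ u
    ≈pre   : ∀ {t u} (μ : Act) → E ⊢ t ≈ u → E ⊢ μ ∙ t ≈ μ ∙ u
    ≈sum   : ∀ {t t' u u'} → E ⊢ t ≈ t' → E ⊢ u ≈ u' → E ⊢ t ⊕ u ≈ t' ⊕ u'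
    ≈par   : ∀ {t t' u u'} → E ⊢ t ≈ t' → E ⊢ u ≈ u' → E ⊢ t ∥ u ≈ t' ∥ u'

  OnlyActionFree : ∀ {E t u} → E ⊢ t ≈ u → Set
  OnlyActionFree {t = t} {u} ≈refl = EqActionFree (t , u)
  OnlyActionFree {t = t} {u} (≈sym d) = EqActionFree (t , u) × OnlyActionFree d
  OnlyActionFree {t = t} {u} (≈trans d₁ d₂) =
    EqActionFree (t , u) × OnlyActionFree d₁ × OnlyActionFree d₂
  OnlyActionFree {t = t} {u} (≈ax {t₀} {u₀} _ _) =
    EqActionFree (t , u) × EqActionFree (t₀ , u₀)
  OnlyActionFree {t = t} {u} (≈pre _ d) = EqActionFree (t , u) × OnlyActionFree d
  OnlyActionFree {t = t} {u} (≈sum d₁ d₂) =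
    EqActionFree (t , u) × OnlyActionFree d₁ × OnlyActionFree d₂
  OnlyActionFree {t = t} {u} (≈par d₁ d₂) =
    EqActionFree (t , u) × OnlyActionFree d₁ × OnlyActionFree d₂

-- A term is action-free iff it contains no prefix; hence action-freeness is
-- reflected by every substitution and preserved by substituting action-free
-- terms such as 𝟎.  A rooted weak bisimulation matches each initial transition
-- of one side by a weak transition of the other, which begins with a strong
-- one, so it relates action-free processes only to action-free processes;
-- closing a sound equation with 𝟎 gives (1).  For (2), both sides of every
-- node of a derivation are action-free or neither is: axiom instances are
-- sound, the congruences for + and ∥ act componentwise, and a prefixed term is
-- never action-free.
module Submission where

open import Defs
open import Data.Empty using (⊥-elim)
open import Data.Nat using (ℕ)
open import Data.Product using (_×_; _,_; proj₁; proj₂; map₂)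
open import Data.Product.Function.NonDependent.Propositional using (_×-⇔_)
open import Function using (_∘_)
open import Function.Bundles using (_⇔_; mk⇔; Equivalence)
open import Function.Construct.Identity using (⇔-id)
open import Function.Construct.Symmetry using (⇔-sym)
open import Function.Construct.Composition using (_⇔-∘_)
open import Relation.Binary.PropositionalEquality as ≡ using (_≡_; refl; cong; cong₂)
open import Relation.Binary.Construct.Closure.ReflexiveTransitive using (ε; _◅_)
open import Relation.Nullary using (¬_)

open Equivalence using (to; from)

module _ {A : Set} where

  private
    variable
      V W X : Set

  subst-step : (σ : V → Term {A} W) {t t' : Term V} {μ : Act} →
    t —[ μ ]→ t' → subst σ t —[ μ ]→ subst σ t'
  subst-step σ pre        = pre
  subst-step σ (sumL s)   = sumL (subst-step σ s)
  subst-step σ (sumR s)   = sumR (subst-step σ s)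
  subst-step σ (parL s)   = parL (subst-step σ s)
  subst-step σ (parR s)   = parR (subst-step σ s)
  subst-step σ (sync s r) = sync (subst-step σ s) (subst-step σ r)

  subst-subst : (σ : V → Term {A} W) (ρ : W → Term X) (t : Term V) →
    subst ρ (subst σ t) ≡ subst (subst ρ ∘ σ) t
  subst-subst σ ρ 𝟎       = refl
  subst-subst σ ρ (var x) = refl
  subst-subst σ ρ (μ ∙ t) = cong (μ ∙_) (subst-subst σ ρ t)
  subst-subst σ ρ (t ⊕ u) = cong₂ _⊕_ (subst-subst σ ρ t) (subst-subst σ ρ u)
  subst-subst σ ρ (t ∥ u) = cong₂ _∥_ (subst-subst σ ρ t) (subst-subst σ ρ u)

  actionFree-𝟎 : ActionFree (𝟎 {A} {V})
  actionFree-𝟎 _ _ ()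

  ¬actionFree-∙ : ∀ μ (t : Term {A} V) → ¬ ActionFree (μ ∙ t)
  ¬actionFree-∙ μ t af = af μ t pre

  actionFree-⊕ : {t u : Term {A} V} → ActionFree (t ⊕ u) ⇔ (ActionFree t × ActionFree u)
  actionFree-⊕ = mk⇔ (λ af → (λ μ _ → af μ _ ∘ sumL) , (λ μ _ → af μ _ ∘ sumR)) split
    where
    split : ∀ {t u} → ActionFree t × ActionFree u → ActionFree (t ⊕ u)
    split (af , _) μ _ (sumL s) = af μ _ s
    split (_ , af) μ _ (sumR s) = af μ _ s

  actionFree-∥ : {t u : Term {A} V} → ActionFree (t ∥ u) ⇔ (ActionFree t × ActionFree u)
  actionFree-∥ = mk⇔ (λ af → (λ μ _ → af μ _ ∘ parL) , (λ μ _ → af μ _ ∘ parR)) split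
    where
    split : ∀ {t u} → ActionFree t × ActionFree u → ActionFree (t ∥ u)
    split (af , _) μ _ (parL s)   = af μ _ s
    split (_ , af) μ _ (parR s)   = af μ _ s
    split (af , _) μ _ (sync s _) = af _ _ s

  actionFree-subst⁻ : (σ : V → Term {A} W) (t : Term V) →
    ActionFree (subst σ t) → ActionFree t
  actionFree-subst⁻ σ t af μ t' = af μ (subst σ t') ∘ subst-step σ

  actionFree-subst : {σ : V → Term {A} W} → (∀ x → ActionFree (σ x)) →
    (t : Term V) → ActionFree t → ActionFree (subst σ t)
  actionFree-subst σ-af (var x) _  = σ-af x
  actionFree-subst σ-af 𝟎       _  = actionFree-𝟎
  actionFree-subst σ-af (μ ∙ t) af = ⊥-elim (¬actionFree-∙ μ t af)
  actionFree-subst σ-af (t ⊕ u) af =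
    let aft , afu = to actionFree-⊕ af
    in from actionFree-⊕ (actionFree-subst σ-af t aft , actionFree-subst σ-af u afu)
  actionFree-subst σ-af (t ∥ u) af =
    let aft , afu = to actionFree-∥ af
    in from actionFree-∥ (actionFree-subst σ-af t aft , actionFree-subst σ-af u afu)

  actionFree⇒¬⇒̂ : {p q : Proc {A}} {μ : Act} → ActionFree p → ¬ p ⇒̂[ μ ] q
  actionFree⇒¬⇒̂ af (_ , _ , ε     , s , _) = af _ _ s
  actionFree⇒¬⇒̂ af (_ , _ , r ◅ _ , _ , _) = af _ _ r

  ~WB-sym : {p q : Proc {A}} → p ~WB q → q ~WB p
  ~WB-sym (R , bisim@(sym , _) , pRq) = R , bisim , sym pRq

  ~RWB-sym : {p q : Proc {A}} → p ~RWB q → q ~RWB p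
  ~RWB-sym (forth , back) = (λ s → map₂ (map₂ ~WB-sym) (back s)) ,
                            (λ s → map₂ (map₂ ~WB-sym) (forth s))

  ~RWB-actionFree : {p q : Proc {A}} → p ~RWB q → ActionFree p → ActionFree q
  ~RWB-actionFree (_ , back) af μ q' s = actionFree⇒¬⇒̂ af (proj₁ (proj₂ (back s)))

  soundEq-sym : {t u : OTerm {A}} → SoundEq (t , u) → SoundEq (u , t)
  soundEq-sym sound σ = ~RWB-sym (sound σ)

  soundEq-subst : {t u : OTerm {A}} → SoundEq (t , u) →
    (σ : ℕ → OTerm {A}) → SoundEq (subst σ t , subst σ u)
  soundEq-subst {t} {u} sound σ ρ =
    ≡.subst₂ _~RWB_ (≡.sym (subst-subst σ ρ t)) (≡.sym (subst-subst σ ρ u))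
      (sound (subst ρ ∘ σ))

  soundEq-actionFree : (t u : OTerm {A}) → SoundEq (t , u) → ActionFree t → ActionFree u
  soundEq-actionFree t u sound af =
    actionFree-subst⁻ close u
      (~RWB-actionFree (sound close) (actionFree-subst (λ _ → actionFree-𝟎) t af))
    where
    close : ℕ → Proc {A}
    close _ = 𝟎

  soundEq-actionFree⇔ : (t u : OTerm {A}) → SoundEq (t , u) → ActionFree t ⇔ ActionFree u
  soundEq-actionFree⇔ t u sound =
    mk⇔ (soundEq-actionFree t u sound) (soundEq-actionFree u t (soundEq-sym {t} {u} sound))

  module _ {E : Equation {A} → Set} (sound : Sound E) where

    ⊢-actionFree⇔ : {t u : OTerm {A}} → E ⊢ t ≈ u → ActionFree t ⇔ ActionFree u
    ⊢-actionFree⇔ {t} ≈refl      = ⇔-id (ActionFree t)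
    ⊢-actionFree⇔ (≈sym d)       = ⇔-sym (⊢-actionFree⇔ d)
    ⊢-actionFree⇔ (≈trans d₁ d₂) = ⊢-actionFree⇔ d₂ ⇔-∘ ⊢-actionFree⇔ d₁
    ⊢-actionFree⇔ (≈ax {t} {u} e σ) =
      soundEq-actionFree⇔ (subst σ t) (subst σ u) (soundEq-subst {t} {u} (sound _ e) σ)
    ⊢-actionFree⇔ (≈pre {t} {u} μ _) =
      mk⇔ (⊥-elim ∘ ¬actionFree-∙ μ t) (⊥-elim ∘ ¬actionFree-∙ μ u)
    ⊢-actionFree⇔ (≈sum d₁ d₂) =
      ⇔-sym actionFree-⊕ ⇔-∘ ((⊢-actionFree⇔ d₁ ×-⇔ ⊢-actionFree⇔ d₂) ⇔-∘ actionFree-⊕)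
    ⊢-actionFree⇔ (≈par d₁ d₂) =
      ⇔-sym actionFree-∥ ⇔-∘ ((⊢-actionFree⇔ d₁ ×-⇔ ⊢-actionFree⇔ d₂) ⇔-∘ actionFree-∥)

    ⊢-eqActionFree : {t u : OTerm {A}} → E ⊢ t ≈ u → ActionFree t → EqActionFree (t , u)
    ⊢-eqActionFree d af = af , to (⊢-actionFree⇔ d) af

    ⊢-onlyActionFree : {t u : OTerm {A}} (d : E ⊢ t ≈ u) → ActionFree t → OnlyActionFree d
    ⊢-onlyActionFree ≈refl af = af , af
    ⊢-onlyActionFree d@(≈sym d₀) af =
      ⊢-eqActionFree d af , ⊢-onlyActionFree d₀ (from (⊢-actionFree⇔ d₀) af)
    ⊢-onlyActionFree d@(≈trans d₁ d₂) af =
      ⊢-eqActionFree d af ,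
      ⊢-onlyActionFree d₁ af , ⊢-onlyActionFree d₂ (to (⊢-actionFree⇔ d₁) af)
    ⊢-onlyActionFree d@(≈ax {t₀} {u₀} e σ) af =
      ⊢-eqActionFree d af , af₀ , soundEq-actionFree t₀ u₀ (sound _ e) af₀
      where af₀ = actionFree-subst⁻ σ t₀ af
    ⊢-onlyActionFree (≈pre {t} μ _) af = ⊥-elim (¬actionFree-∙ μ t af)
    ⊢-onlyActionFree d@(≈sum d₁ d₂) af =
      let af₁ , af₂ = to actionFree-⊕ af
      in ⊢-eqActionFree d af , ⊢-onlyActionFree d₁ af₁ , ⊢-onlyActionFree d₂ af₂
    ⊢-onlyActionFree d@(≈par d₁ d₂) af =
      let af₁ , af₂ = to actionFree-∥ af
      in ⊢-eqActionFree d af , ⊢-onlyActionFree d₁ af₁ , ⊢-onlyActionFree d₂ af₂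

proposition3 : {A : Set} (E : Equation {A} → Set) → Sound E →
    ((t u : OTerm {A}) → SoundEq (t , u) → ActionFree t → ActionFree u) ×
    ((t u : OTerm {A}) → (d : E ⊢ t ≈ u) → ActionFree t → OnlyActionFree d)
proposition3 E sound =
  soundEq-actionFree , (λ _ _ → ⊢-onlyActionFree sound)
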